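{- Let $G=(V,E)$ be a finite simple graph, write $T\chi^o_G(q)=\sum_\alpha c^o_\alpha(q)M_\alpha$ and $\chi_G=\sum_\lambda c_\lambda m_\lambda$. Then for every composition $\alpha$, $[q^{|E|}]c^o_\alpha(q)=c_{\mathrm{sort}(\alpha)}$.
   Context: An orientation $\gamma$ of $G$ directs each edge; it is acyclic if there is no directed cycle. For a proper coloring $\kappa:V\to\mathbb{Z}_{>0}$, $\mathrm{asc}^\gamma(\kappa)$ is the number of edges oriented $u\to v$ with $\kappa(u)<\kappa(v)$; $\chi^\gamma_G(x;q)=\sum_\kappa q^{\mathrm{asc}^\gamma(\kappa)}x^\kappa$ with $x^\kappa=\prod_j x_j^{\#\kappa^{ -1}(j)}$; $T\chi^o_G(q)=\sum_\gamma\chi^\gamma_G(x;q)$ over acyclic orientations. $\chi_G=\sum_\kappa x^\kappa$ is Stanley's chromatic symmetric function (sum over proper colorings). $M_\alpha=\sum_{i_1<\dots<i_\ell}x_{i_1}^{\alpha_1}\cdots x_{i_\ell}^{\alpha_\ell}$ is the monomial quasisymmetric function, $m_\lambda$ the monomial symmetric function, and $\mathrm{sort}(\alpha)$ the partition obtained by sorting the parts of $\alpha$ in weakly decreasing order. -}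

module Defs where

open import Data.Bool using (Bool; true; false; if_then_else_; _∧_)
open import Data.Nat using (ℕ; zero; suc; _<ᵇ_)
open import Data.Fin using (Fin; toℕ)
open import Data.Fin.Properties using (_≟_)
open import Data.List using (List; []; _∷_; [_]; map; concatMap; allFin;
  cartesianProduct; filterᵇ; length; zipWith; lookup)
open import Data.List.Membership.Propositional using (_∈_)
open import Data.List.Relation.Unary.All using (All)
open import Data.Vec as Vec using (Vec; toList)
open import Data.Product using (_×_; _,_; Σ)
open import Relation.Nullary using (¬_; does)
open import Relation.Binary.PropositionalEquality using (_≡_; _≢_)

record Graph (n : ℕ) : Set where
  field
    adj   : Fin n → Fin n → Bool
    sym   : ∀ i j → adj i j ≡ adj j i
    irrefl : ∀ i → adj i i ≡ false
open Graph public

edges : ∀ {n} → Graph n → List (Fin n × Fin n)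
edges {n} G = filterᵇ (λ { (i , j) → (toℕ i <ᵇ toℕ j) ∧ adj G i j })
                      (cartesianProduct (allFin n) (allFin n))

numEdges : ∀ {n} → Graph n → ℕ
numEdges G = length (edges G)

-- Orientations: one Bool per edge (i , j) ∈ edges G (with i < j);
-- true means i → j, false means j → i.
Orientation : ∀ {n} → Graph n → Set
Orientation G = Vec Bool (numEdges G)

arcs : ∀ {n} (G : Graph n) → Orientation G → List (Fin n × Fin n)
arcs G γ = zipWith (λ { (i , j) b → if b then (i , j) else (j , i) })
                   (edges G) (toList γ)

data Path {n} (G : Graph n) (γ : Orientation G) : Fin n → Fin n → Set where
  arc  : ∀ {u v} → (u , v) ∈ arcs G γ → Path G γ u v
  _∷ₚ_ : ∀ {u w v} → (u , w) ∈ arcs G γ → Path G γ w v → Path G γ u v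

Acyclic : ∀ {n} (G : Graph n) → Orientation G → Set
Acyclic G γ = ∀ v → ¬ Path G γ v v

-- Colorings with colors in {1,…,ℓ}; color index c : Fin ℓ stands for c+1.
Coloring : ℕ → ℕ → Set
Coloring n ℓ = Vec (Fin ℓ) n

Proper : ∀ {n ℓ} → Graph n → Coloring n ℓ → Set
Proper G κ = All (λ { (u , v) → Vec.lookup κ u ≢ Vec.lookup κ v }) (edges G)

asc : ∀ {n ℓ} (G : Graph n) → Orientation G → Coloring n ℓ → ℕ
asc G γ κ = length (filterᵇ (λ { (u , v) → toℕ (Vec.lookup κ u) <ᵇ toℕ (Vec.lookup κ v) })
                           (arcs G γ))

HasContent : ∀ {n} (α : List ℕ) → Coloring n (length α) → Set
HasContent α κ = ∀ (c : Fin (length α)) →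
  length (filterᵇ (λ d → does (d ≟ c)) (toList κ)) ≡ lookup α c

allVecs : ∀ {A : Set} → List A → (n : ℕ) → List (Vec A n)
allVecs xs zero    = [ Vec.[] ]
allVecs xs (suc n) = concatMap (λ x → map (x Vec.∷_) (allVecs xs n)) xs

allOrientations : ∀ {n} (G : Graph n) → List (Orientation G)
allOrientations G = allVecs (true ∷ false ∷ []) (numEdges G)

allColorings : (n ℓ : ℕ) → List (Coloring n ℓ)
allColorings n ℓ = allVecs (allFin ℓ) n

-- Relational count: Count P xs k  means exactly k entries of xs satisfy P
-- (usable for predicates not given with a decision procedure).
data Count {A : Set} (P : A → Set) : List A → ℕ → Set where
  c[]  : Count P [] 0
  cyes : ∀ {x xs k} → P x → Count P xs k → Count P (x ∷ xs) (suc k)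
  cno  : ∀ {x xs k} → ¬ P x → Count P xs k → Count P (x ∷ xs) k

-- [q^k] c^o_α(q): number of pairs (γ, κ) with γ acyclic, κ proper,
-- x^κ = x_1^{α_1}⋯x_ℓ^{α_ℓ}, and asc^γ(κ) = k.
TermCO : ∀ {n} (G : Graph n) (α : List ℕ) (k : ℕ) →
         Orientation G × Coloring n (length α) → Set
TermCO G α k (γ , κ) = Acyclic G γ × Proper G κ × HasContent α κ × asc G γ κ ≡ k

CoeffCO : ∀ {n} (G : Graph n) (α : List ℕ) (k : ℕ) → ℕ → Set
CoeffCO {n} G α k = Count (TermCO G α k)
  (cartesianProduct (allOrientations G) (allColorings n (length α)))

-- c_λ: coefficient of m_λ in χ_G = coefficient of x_1^{λ_1}⋯x_ℓ^{λ_ℓ},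
-- i.e. number of proper colorings κ with that content.
CoeffChi : ∀ {n} (G : Graph n) (λ' : List ℕ) → ℕ → Set
CoeffChi {n} G λ' = Count (λ κ → Proper G κ × HasContent λ' κ)
  (allColorings n (length λ'))

{-# OPTIONS --safe #-}
-- For a proper colouring κ, asc^γ(κ) = |E| exactly when γ orients every edge towards its
-- larger colour, and this orientation is acyclic because colours increase strictly along
-- directed paths. So the pairs (γ, κ) counted by [q^|E|] c^o_α are in bijection with the
-- proper colourings of content α. Relabelling the colours along a permutation α ↭ sort(α)
-- is a bijection from those onto the proper colourings of content sort(α), counted by c_sort(α).
module Submission where

open import Defs hiding (sym)
open import Data.Bool using (Bool; true; false; not; if_then_else_; T)
open import Data.Bool.Properties using (T-≡; T-not-≡)
open import Data.Fin using (Fin; zero; suc; toℕ)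
open import Data.Fin.Permutation using (Permutation; _⟨$⟩ʳ_; _⟨$⟩ˡ_; inverseʳ)
open import Data.Fin.Properties using (_≟_; toℕ-injective; suc-injective)
import Data.Fin.Properties as Fin
open import Data.List using (List; []; _∷_; _++_; map; concatMap; cartesianProductWith;
  cartesianProduct; filterᵇ; length; zipWith; allFin; lookup)
open import Data.List.Properties using (map-++; map-∘; map-tabulate; cartesianProductWith-zeroʳ;
  filter-all; filter-complete; length-zipWith)
open import Data.List.Relation.Unary.All as All using (All; []; _∷_)
open import Data.List.Relation.Unary.All.Properties using (all-filter)
open import Data.List.Relation.Unary.Linked using (Linked)
open import Data.List.Relation.Binary.Permutation.Propositional as ↭
  using (_↭_; ↭-trans; ↭-reflexive; ↭⇒↭ₛ; module PermutationReasoning)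
open import Data.List.Relation.Binary.Permutation.Propositional.Properties using (shifts; ++⁺ˡ)
open import Data.List.Relation.Binary.Permutation.Homogeneous using (onIndices)
open import Data.Nat using (ℕ; zero; suc; _+_; _<_; _≥_; _<ᵇ_; _⊓_)
open import Data.Nat.Properties using (<ᵇ⇒<; <-trans; <-irrefl; ⊓-idem)
import Data.Nat.Properties as ℕ
open import Data.Product using (_×_; _,_; proj₁; proj₂; ∃; swap)
open import Data.Product.Function.NonDependent.Propositional using (_×-⇔_)
open import Data.Vec as Vec using (Vec; toList)
open import Data.Vec.Properties using (∷-injectiveˡ; ∷-injectiveʳ; lookup-map; toList-map;
  length-toList; map-id; map-cong)
import Data.Vec.Properties as Vecₚ
open import Function using (id; _∘_; _⇔_; _↔_; mk⇔; mk↔ₛ′; Equivalence; Inverse; Injection)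
open import Function.Definitions using (Injective)
import Function.Properties.Equivalence as ⇔
open import Function.Properties.Inverse using (↔⇒↣)
open import Relation.Nullary using (¬_; Dec; yes; no; does; contradiction)
open import Relation.Nullary.Decidable using (_×-dec_; ¬?; T?)
open import Relation.Unary using (Decidable)
open import Relation.Binary.PropositionalEquality
  using (_≡_; _≢_; refl; sym; trans; cong; cong₂; subst; setoid; module ≡-Reasoning)
open import Data.List.Relation.Binary.Permutation.Setoid.Properties (setoid ℕ) using (onIndices-lookup)

private
  variable
    A B C : Set
    P Q : A → Set
    xs ys : List A
    k l m : ℕ

count-unique : Count P xs k → Count P xs l → k ≡ l
count-unique c[]        c[]        = refl
count-unique (cyes _ c) (cyes _ d) = cong suc (count-unique c d)
count-unique (cyes p _) (cno ¬p _) = contradiction p ¬p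
count-unique (cno ¬p _) (cyes p _) = contradiction p ¬p
count-unique (cno _ c)  (cno _ d)  = count-unique c d

count-exists : Decidable P → (xs : List A) → ∃ (Count P xs)
count-exists P? []       = 0 , c[]
count-exists P? (x ∷ xs) with count-exists P? xs | P? x
... | k , c | yes p  = suc k , cyes p c
... | k , c | no  ¬p = k , cno ¬p c

count-none : (∀ {x} → ¬ P x) → Count P xs 0
count-none {xs = []}     ¬P = c[]
count-none {xs = x ∷ xs} ¬P = cno ¬P (count-none ¬P)

count-++ : Count P xs k → Count P ys l → Count P (xs ++ ys) (k + l)
count-++ c[]        d = d
count-++ (cyes p c) d = cyes p (count-++ c d)
count-++ (cno ¬p c) d = cno ¬p (count-++ c d)

count-↭ : xs ↭ ys → Count P xs k → Count P ys k
count-↭ ↭.refl         c                   = c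
count-↭ (↭.prep _ ρ)   (cyes p c)          = cyes p (count-↭ ρ c)
count-↭ (↭.prep _ ρ)   (cno ¬p c)          = cno ¬p (count-↭ ρ c)
count-↭ (↭.swap _ _ ρ) (cyes p (cyes q c)) = cyes q (cyes p (count-↭ ρ c))
count-↭ (↭.swap _ _ ρ) (cyes p (cno ¬q c)) = cno ¬q (cyes p (count-↭ ρ c))
count-↭ (↭.swap _ _ ρ) (cno ¬p (cyes q c)) = cyes q (cno ¬p (count-↭ ρ c))
count-↭ (↭.swap _ _ ρ) (cno ¬p (cno ¬q c)) = cno ¬q (cno ¬p (count-↭ ρ c))
count-↭ (↭.trans ρ σ)  c                   = count-↭ σ (count-↭ ρ c)

count-transport : Count P xs k → Count Q ys k → Count P xs l → Count Q ys l
count-transport {Q = Q} {ys = ys} cP cQ cP′ = subst (Count Q ys) (count-unique cP cP′) cQ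

count-resp-⇔ : (∀ {x} → P x ⇔ Q x) → Count P xs k → Count Q xs k
count-resp-⇔ P⇔Q c[]        = c[]
count-resp-⇔ P⇔Q (cyes p c) = cyes (Equivalence.to P⇔Q p) (count-resp-⇔ P⇔Q c)
count-resp-⇔ P⇔Q (cno ¬p c) = cno (¬p ∘ Equivalence.from P⇔Q) (count-resp-⇔ P⇔Q c)

count-map : (f : A → B) → Count (P ∘ f) xs k → Count P (map f xs) k
count-map f c[]        = c[]
count-map f (cyes p c) = cyes p (count-map f c)
count-map f (cno ¬p c) = cno ¬p (count-map f c)

count-cartesianProductWith : {f : A → B → C} {R : C → Set} →
  (∀ {x y} → R (f x y) → P x) → (∀ x → P x → Count (R ∘ f x) ys 1) →
  Count P xs k → Count R (cartesianProductWith f xs ys) k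
count-cartesianProductWith R⇒P unique c[] = c[]
count-cartesianProductWith {f = f} R⇒P unique (cyes p c) =
  count-++ (count-map (f _) (unique _ p)) (count-cartesianProductWith R⇒P unique c)
count-cartesianProductWith {f = f} R⇒P unique (cno ¬p c) =
  count-++ (count-map (f _) (count-none (¬p ∘ R⇒P))) (count-cartesianProductWith R⇒P unique c)

cartesianProduct-∷-↭ : (x : B) (ys : List A) (xs : List B) →
  map (_, x) ys ++ cartesianProduct ys xs ↭ cartesianProduct ys (x ∷ xs)
cartesianProduct-∷-↭ x []       xs = ↭.refl
cartesianProduct-∷-↭ x (y ∷ ys) xs = ↭.prep (y , x)
  (↭-trans (shifts (map (_, x) ys) (map (y ,_) xs)) (++⁺ˡ (map (y ,_) xs) (cartesianProduct-∷-↭ x ys xs)))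

cartesianProduct-swap-↭ : (xs : List A) (ys : List B) →
  map swap (cartesianProduct xs ys) ↭ cartesianProduct ys xs
cartesianProduct-swap-↭ []       ys = ↭-reflexive (sym (cartesianProductWith-zeroʳ _,_ ys))
cartesianProduct-swap-↭ (x ∷ xs) ys = begin
  map swap (map (x ,_) ys ++ cartesianProduct xs ys)            ≡⟨ map-++ swap (map (x ,_) ys) _ ⟩
  map swap (map (x ,_) ys) ++ map swap (cartesianProduct xs ys) ≡⟨ cong (_++ _) (sym (map-∘ ys)) ⟩
  map (_, x) ys ++ map swap (cartesianProduct xs ys)            ↭⟨ ++⁺ˡ (map (_, x) ys) (cartesianProduct-swap-↭ xs ys) ⟩
  map (_, x) ys ++ cartesianProduct ys xs                       ↭⟨ cartesianProduct-∷-↭ x ys xs ⟩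
  cartesianProduct ys (x ∷ xs)                                  ∎
  where open PermutationReasoning

count-swap : {R : A × B → Set} (xs : List A) (ys : List B) →
  Count (R ∘ swap) (cartesianProduct ys xs) k → Count R (cartesianProduct xs ys) k
count-swap xs ys c = count-↭ (cartesianProduct-swap-↭ ys xs) (count-map swap c)

Enumeration : List A → Set
Enumeration {A} xs = (a : A) → Count (a ≡_) xs 1

-- Both sides count the graph of `to` restricted to P: once along xs, once along ys.
count-↔ : Enumeration xs → Enumeration ys → (f : A ↔ B) → (∀ {x} → P x ⇔ Q (Inverse.to f x)) →
  Decidable Q → Count P xs k → Count Q ys k
count-↔ {xs = xs} {ys = ys} {P = P} {Q = Q} enumX enumY f P⇔Q Q? cP =
  count-transport byColumns cQ byRows
  where
  open Inverse f
  Related : _ × _ → Set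
  Related (x , y) = P x × to x ≡ y
  cQ : Count Q ys _
  cQ = proj₂ (count-exists Q? ys)
  byRows : Count Related (cartesianProduct xs ys) _
  byRows = count-cartesianProductWith proj₁ (λ x p → count-resp-⇔ (mk⇔ (p ,_) proj₂) (enumY (to x))) cP
  partner : ∀ {x y} → Q y → from y ≡ x ⇔ Related (x , y)
  partner {y = y} q = mk⇔
    (λ { refl → Equivalence.from P⇔Q (subst Q (sym (strictlyInverseˡ y)) q) , strictlyInverseˡ y })
    (λ { (_ , refl) → strictlyInverseʳ _ })
  byColumns : Count Related (cartesianProduct xs ys) _
  byColumns = count-swap xs ys
    (count-cartesianProductWith {f = _,_} (λ { (p , refl) → Equivalence.to P⇔Q p })
                                (λ y q → count-resp-⇔ (partner q) (enumX (from y))) cQ)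

Bool-enumeration : Enumeration (true ∷ false ∷ [])
Bool-enumeration true  = cyes refl (cno (λ ()) c[])
Bool-enumeration false = cno (λ ()) (cyes refl c[])

allFin-suc : ∀ ℓ → allFin (suc ℓ) ≡ zero ∷ map suc (allFin ℓ)
allFin-suc ℓ = cong (zero ∷_) (sym (map-tabulate id suc))

allFin-enumeration : ∀ ℓ → Enumeration (allFin ℓ)
allFin-enumeration (suc ℓ) zero    rewrite allFin-suc ℓ =
  cyes refl (count-map suc (count-none λ ()))
allFin-enumeration (suc ℓ) (suc i) rewrite allFin-suc ℓ =
  cno (λ ()) (count-map suc (count-resp-⇔ (mk⇔ (cong suc) suc-injective) (allFin-enumeration ℓ i)))

concatMap-map≡cartesianProductWith : (f : A → B → C) (xs : List A) (ys : List B) →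
  concatMap (λ x → map (f x) ys) xs ≡ cartesianProductWith f xs ys
concatMap-map≡cartesianProductWith f []       ys = refl
concatMap-map≡cartesianProductWith f (x ∷ xs) ys =
  cong (map (f x) ys ++_) (concatMap-map≡cartesianProductWith f xs ys)

allVecs-enumeration : Enumeration xs → ∀ n → Enumeration (allVecs xs n)
allVecs-enumeration enum zero    Vec.[]      = cyes refl c[]
allVecs-enumeration {xs = xs} enum (suc n) (a Vec.∷ v) =
  subst (λ vs → Count (a Vec.∷ v ≡_) vs 1)
        (sym (concatMap-map≡cartesianProductWith Vec._∷_ xs (allVecs xs n)))
        (count-cartesianProductWith ∷-injectiveˡ
          (λ { _ refl → count-resp-⇔ (mk⇔ (cong (a Vec.∷_)) ∷-injectiveʳ) (allVecs-enumeration enum n v) })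
          (enum a))

allColorings-enumeration : ∀ n ℓ → Enumeration (allColorings n ℓ)
allColorings-enumeration n ℓ = allVecs-enumeration (allFin-enumeration ℓ) n

allOrientations-enumeration : ∀ {n} (G : Graph n) → Enumeration (allOrientations G)
allOrientations-enumeration G = allVecs-enumeration Bool-enumeration (numEdges G)

ascendsᵇ : (A → ℕ) → A × A → Bool
ascendsᵇ c (u , v) = c u <ᵇ c v

-- `arcs G γ` is definitionally `zipWith orient (edges G) (toList γ)`.
orient : A × A → Bool → A × A
orient e b = if b then e else swap e

<ᵇ-flip : ∀ {m n} → m ≢ n → (n <ᵇ m) ≡ not (m <ᵇ n)
<ᵇ-flip {zero}  {zero}  m≢n = contradiction refl m≢n
<ᵇ-flip {zero}  {suc n} _   = refl
<ᵇ-flip {suc m} {zero}  _   = refl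
<ᵇ-flip {suc m} {suc n} m≢n = <ᵇ-flip (m≢n ∘ cong suc)

module _ (c : A → ℕ) where

  Bichromatic : A × A → Set
  Bichromatic (u , v) = c u ≢ c v

  orient-ascends⇔ : ∀ {e} → Bichromatic e → ∀ b → T (ascendsᵇ c (orient e b)) ⇔ ascendsᵇ c e ≡ b
  orient-ascends⇔ _ true  = T-≡
  orient-ascends⇔ d false rewrite <ᵇ-flip d = T-not-≡

  all-ascend⇔ : (es : List (A × A)) → All Bichromatic es → (γ : Vec Bool (length es)) →
    All (T ∘ ascendsᵇ c) (zipWith orient es (toList γ)) ⇔ Vec.map (ascendsᵇ c) (Vec.fromList es) ≡ γ
  all-ascend⇔ []       []       Vec.[]      = mk⇔ (λ _ → refl) (λ _ → [])
  all-ascend⇔ (e ∷ es) (d ∷ ds) (b Vec.∷ γ) = mk⇔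
    (λ { (a ∷ as) → cong₂ Vec._∷_ (to (orient-ascends⇔ d b) a) (to (all-ascend⇔ es ds γ) as) })
    (λ eq → from (orient-ascends⇔ d b) (∷-injectiveˡ eq) ∷ from (all-ascend⇔ es ds γ) (∷-injectiveʳ eq))
    where open Equivalence

length-filterᵇ≡⇔All : (p : A → Bool) → length xs ≡ m → length (filterᵇ p xs) ≡ m ⇔ All (T ∘ p) xs
length-filterᵇ≡⇔All {xs = xs} p refl = mk⇔
  (λ eq → subst (All (T ∘ p)) (filter-complete (T? ∘ p) eq) (all-filter (T? ∘ p) xs))
  (λ all → cong length (filter-all (T? ∘ p) all))

length-arcs : ∀ {n} (G : Graph n) (γ : Orientation G) → length (arcs G γ) ≡ numEdges G
length-arcs G γ = trans (length-zipWith _ (edges G) (toList γ))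
                        (trans (cong (numEdges G ⊓_) (length-toList γ)) (⊓-idem (numEdges G)))

ascending⇒acyclic : ∀ {n} (G : Graph n) {γ : Orientation G} (c : Fin n → ℕ) →
  All (T ∘ ascendsᵇ c) (arcs G γ) → Acyclic G γ
ascending⇒acyclic G {γ} c ascending v cycle = <-irrefl refl (path-ascends cycle)
  where
  path-ascends : ∀ {u w} → Path G γ u w → c u < c w
  path-ascends (arc uw)  = <ᵇ⇒< _ _ (All.lookup ascending uw)
  path-ascends (uw ∷ₚ p)  = <-trans (<ᵇ⇒< _ _ (All.lookup ascending uw)) (path-ascends p)

module _ {n ℓ} (G : Graph n) (κ : Coloring n ℓ) where

  colourOf : Fin n → ℕ
  colourOf = toℕ ∘ Vec.lookup κ

  ascendingOrientation : Orientation G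
  ascendingOrientation = Vec.map (ascendsᵇ colourOf) (Vec.fromList (edges G))

  proper⇒bichromatic : Proper G κ → All (Bichromatic colourOf) (edges G)
  proper⇒bichromatic = All.map (_∘ toℕ-injective)

  asc≡numEdges⇔ascendingOrientation : Proper G κ → (γ : Orientation G) →
    asc G γ κ ≡ numEdges G ⇔ ascendingOrientation ≡ γ
  asc≡numEdges⇔ascendingOrientation proper γ =
    ⇔.trans (length-filterᵇ≡⇔All (ascendsᵇ colourOf) (length-arcs G γ))
            (all-ascend⇔ colourOf (edges G) (proper⇒bichromatic proper) γ)

  ascendingOrientation-acyclic : Proper G κ → Acyclic G ascendingOrientation
  ascendingOrientation-acyclic proper = ascending⇒acyclic G colourOf
    (Equivalence.from (all-ascend⇔ colourOf (edges G) (proper⇒bichromatic proper) _) refl)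

coeffChi⇒coeffCO : ∀ {n} (G : Graph n) (α : List ℕ) → CoeffChi G α k → CoeffCO G α (numEdges G) k
coeffChi⇒coeffCO {n = n} G α chi =
  count-swap (allOrientations G) (allColorings n (length α))
    (count-cartesianProductWith {f = _,_} {R = TermCO G α (numEdges G) ∘ swap}
      (λ (_ , proper , content , _) → proper , content) uniqueOrientation chi)
  where
  uniqueOrientation : ∀ κ → Proper G κ × HasContent α κ →
    Count (λ γ → TermCO G α (numEdges G) (γ , κ)) (allOrientations G) 1
  uniqueOrientation κ (proper , content) = count-resp-⇔
    (mk⇔ (λ { refl → ascendingOrientation-acyclic G κ proper , proper , content ,
                     Equivalence.from (asc≡numEdges⇔ascendingOrientation G κ proper _) refl })
         (λ (_ , _ , _ , top) → Equivalence.to (asc≡numEdges⇔ascendingOrientation G κ proper _) top))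
    (allOrientations-enumeration G (ascendingOrientation G κ))

multiplicity : ∀ {ℓ} → Fin ℓ → List (Fin ℓ) → ℕ
multiplicity c = length ∘ filterᵇ (λ d → does (d ≟ c))

multiplicity-map : ∀ {ℓ ℓ′} {f : Fin ℓ → Fin ℓ′} → Injective _≡_ _≡_ f →
  ∀ c ds → multiplicity (f c) (map f ds) ≡ multiplicity c ds
multiplicity-map inj c [] = refl
multiplicity-map {f = f} inj c (d ∷ ds) with f d ≟ f c | d ≟ c
... | yes _     | yes _   = cong suc (multiplicity-map inj c ds)
... | no  _     | no  _   = multiplicity-map inj c ds
... | yes fd≡fc | no d≢c  = contradiction (inj fd≡fc) d≢c
... | no  fd≢fc | yes d≡c = contradiction (cong f d≡c) fd≢fc

Vec-map-↔ : ∀ {n} → A ↔ B → Vec A n ↔ Vec B n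
Vec-map-↔ f = mk↔ₛ′ (Vec.map to) (Vec.map from)
                    (map-inverse strictlyInverseˡ) (map-inverse strictlyInverseʳ)
  where
  open Inverse f
  map-inverse : ∀ {n} {g : A → B} {h : B → A} → (∀ x → g (h x) ≡ x) →
                (v : Vec B n) → Vec.map g (Vec.map h v) ≡ v
  map-inverse {g = g} {h} gh v = trans (sym (Vecₚ.map-∘ g h v)) (trans (map-cong gh v) (map-id v))

module _ {n} (G : Graph n) where

  proper? : ∀ {ℓ} (κ : Coloring n ℓ) → Dec (Proper G κ)
  proper? κ = All.all? (λ (u , v) → ¬? (Vec.lookup κ u ≟ Vec.lookup κ v)) (edges G)

  proper-map⇔ : ∀ {ℓ ℓ′} {f : Fin ℓ → Fin ℓ′} → Injective _≡_ _≡_ f →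
    (κ : Coloring n ℓ) → Proper G κ ⇔ Proper G (Vec.map f κ)
  proper-map⇔ {f = f} inj κ = mk⇔
    (All.map λ {(u , v)} κu≢κv fκu≡fκv → κu≢κv (inj (begin
      f (Vec.lookup κ u)          ≡⟨ lookup-map u f κ ⟨
      Vec.lookup (Vec.map f κ) u  ≡⟨ fκu≡fκv ⟩
      Vec.lookup (Vec.map f κ) v  ≡⟨ lookup-map v f κ ⟩
      f (Vec.lookup κ v)          ∎)))
    (All.map λ {(u , v)} fκu≢fκv κu≡κv → fκu≢fκv (begin
      Vec.lookup (Vec.map f κ) u  ≡⟨ lookup-map u f κ ⟩
      f (Vec.lookup κ u)          ≡⟨ cong f κu≡κv ⟩
      f (Vec.lookup κ v)          ≡⟨ lookup-map v f κ ⟨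
      Vec.lookup (Vec.map f κ) v  ∎))
    where open ≡-Reasoning

hasContent? : ∀ {n} (α : List ℕ) (κ : Coloring n (length α)) → Dec (HasContent α κ)
hasContent? α κ = Fin.all? (λ c → multiplicity c (toList κ) ℕ.≟ lookup α c)

content-permute⇔ : ∀ {n} {α β : List ℕ} (π : Permutation (length α) (length β)) →
  (∀ i → lookup α i ≡ lookup β (π ⟨$⟩ʳ i)) →
  (κ : Coloring n (length α)) → HasContent α κ ⇔ HasContent β (Vec.map (π ⟨$⟩ʳ_) κ)
content-permute⇔ {α = α} {β} π lookup-π κ = mk⇔ permuted unpermuted
  where
  open ≡-Reasoning
  recoloured : List (Fin (length β))
  recoloured = toList (Vec.map (π ⟨$⟩ʳ_) κ)
  multiplicity-recoloured : ∀ i → multiplicity (π ⟨$⟩ʳ i) recoloured ≡ multiplicity i (toList κ)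
  multiplicity-recoloured i = trans (cong (multiplicity _) (toList-map _ κ))
                                    (multiplicity-map (Injection.injective (↔⇒↣ π)) i (toList κ))
  permuted : HasContent α κ → HasContent β (Vec.map (π ⟨$⟩ʳ_) κ)
  permuted content c = begin
    multiplicity c recoloured                       ≡⟨ cong (λ d → multiplicity d recoloured) (inverseʳ π) ⟨
    multiplicity (π ⟨$⟩ʳ (π ⟨$⟩ˡ c)) recoloured     ≡⟨ multiplicity-recoloured (π ⟨$⟩ˡ c) ⟩
    multiplicity (π ⟨$⟩ˡ c) (toList κ)              ≡⟨ content (π ⟨$⟩ˡ c) ⟩
    lookup α (π ⟨$⟩ˡ c)                             ≡⟨ lookup-π (π ⟨$⟩ˡ c) ⟩
    lookup β (π ⟨$⟩ʳ (π ⟨$⟩ˡ c))                    ≡⟨ cong (lookup β) (inverseʳ π) ⟩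
    lookup β c                                      ∎
  unpermuted : HasContent β (Vec.map (π ⟨$⟩ʳ_) κ) → HasContent α κ
  unpermuted content i = begin
    multiplicity i (toList κ)               ≡⟨ multiplicity-recoloured i ⟨
    multiplicity (π ⟨$⟩ʳ i) recoloured      ≡⟨ content (π ⟨$⟩ʳ i) ⟩
    lookup β (π ⟨$⟩ʳ i)                     ≡⟨ lookup-π i ⟨
    lookup α i                              ∎

coeffChi-↭ : ∀ {n} (G : Graph n) {α β : List ℕ} → α ↭ β → CoeffChi G α k → CoeffChi G β k
coeffChi-↭ {n = n} G {α} {β} α↭β = count-↔
  (allColorings-enumeration n (length α)) (allColorings-enumeration n (length β))
  (Vec-map-↔ π)
  (λ {κ} → proper-map⇔ G (Injection.injective (↔⇒↣ π)) κ
           ×-⇔ content-permute⇔ {α = α} {β} π (onIndices-lookup (↭⇒↭ₛ α↭β)) κ)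
  (λ κ → proper? G κ ×-dec hasContent? β κ)
  where
  π : Permutation (length α) (length β)
  π = onIndices (↭⇒↭ₛ α↭β)

proposition3p9 : ∀ {n} (G : Graph n) (α : List ℕ) → All (λ a → 0 < a) α →
    (λ' : List ℕ) → Linked _≥_ λ' → α ↭ λ' →
    ∀ c → (CoeffCO G α (numEdges G) c → CoeffChi G λ' c)
        × (CoeffChi G λ' c → CoeffCO G α (numEdges G) c)
proposition3p9 {n} G α _ λ' _ α↭λ' c = count-transport top chiλ' , count-transport chiλ' top
  where
  chiα : CoeffChi G α _
  chiα = proj₂ (count-exists (λ κ → proper? G κ ×-dec hasContent? α κ) (allColorings n (length α)))
  top : CoeffCO G α (numEdges G) _
  top = coeffChi⇒coeffCO G α chiα
  chiλ' : CoeffChi G λ' _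
  chiλ' = coeffChi-↭ G α↭λ' chiα
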